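{- For any integer $d\ge 2$, $\operatorname{msad}_3(T_d)=\infty$ if $d=2$, $\operatorname{msad}_3(T_d)=2$ if $d=3$, and $\operatorname{msad}_3(T_d)=1$ if $d>3$.
   Context: For $d\ge 1$, $T_d$ is the complete binary tree of height $d$: a tree with a root $r$ of degree 2, all leaves at distance exactly $d$ from $r$, and every other vertex of degree 3. For a connected graph $G$, $S\subseteq V(G)$ and $v\in V(G)$, $m(v|S)$ is the multiset $\{\!\{d_G(v,s): s\in S\}\!\}$ of shortest-path distances. A nonempty set $S\subsetneq V(G)$ is a $k$-multiset antiresolving set ($k$-MARS) if $k$ equals the minimum size of an equivalence class of the relation on $V(G)\setminus S$ given by $u\sim v \iff m(u|S)=m(v|S)$. $\operatorname{msad}_k(G)$ is the minimum cardinality of a $k$-MARS of $G$, with $\operatorname{msad}_k(G)=\infty$ if $G$ has no $k$-MARS. -}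

module Defs where

open import Data.Nat using (ℕ; zero; suc; _+_; _*_; _∸_; _^_; _≤_; _≡ᵇ_)
open import Data.Bool using (Bool; true; false; _∧_; _∨_; if_then_else_)
open import Data.Fin using (Fin; toℕ)
open import Data.Fin.Subset using (Subset; _∈_; _∉_; ∣_∣; Nonempty; ⁅_⁆; _∪_)
open import Data.Fin.Subset.Properties using (_∈?_)
open import Data.Vec using (lookup; tabulate)
open import Data.List using (List; length; filter)
open import Data.Bool.ListAction using (any)
open import Data.List.Base using (allFin)
open import Data.List.Relation.Unary.Unique.Propositional using (Unique)
import Data.List.Membership.Propositional as LM
open import Data.Product using (Σ; ∃; _×_; _,_)
open import Data.Maybe using (Maybe; just; nothing)
open import Relation.Nullary using (¬_)
open import Relation.Nullary.Decidable using (_×-dec_)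
open import Relation.Binary.PropositionalEquality using (_≡_)
open import Function.Bundles using (_⇔_)
import Data.Nat as ℕ

record Graph : Set where
  field
    N   : ℕ
    adj : Fin N → Fin N → Bool

open Graph public

module _ (G : Graph) where

  private
    n = N G

  neighbours : Subset n → Subset n
  neighbours X = tabulate λ w → any (λ x → lookup X x ∧ adj G x w) (allFin n)

  ball : ℕ → Fin n → Subset n
  ball zero    u = ⁅ u ⁆
  ball (suc k) u = ball k u ∪ neighbours (ball k u)

  search : ℕ → ℕ → Fin n → Fin n → ℕ
  search zero     k u v = k
  search (suc f)  k u v = if lookup (ball k u) v then k else search f (suc k) u v

  -- shortest-path distance d_G(u,v) (for connected graphs every distance is < N)
  dist : Fin n → Fin n → ℕ
  dist u v = search n 0 u v

  -- the multiset m(v|S) = {{ d(v,s) : s ∈ S }}, as its multiplicity function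
  mult : Subset n → Fin n → ℕ → ℕ
  mult S v j = length (filter (λ s → (s ∈? S) ×-dec (dist v s ℕ.≟ j)) (allFin n))

  SameMultiset : Subset n → Fin n → Fin n → Set
  SameMultiset S u v = ∀ j → mult S u j ≡ mult S v j

  ClassSize : Subset n → Fin n → ℕ → Set
  ClassSize S u c =
    Σ (List (Fin n)) λ l →
      Unique l × length l ≡ c ×
      (∀ v → (v LM.∈ l) ⇔ (v ∉ S × SameMultiset S v u))

  IsMARS : ℕ → Subset n → Set
  IsMARS k S =
    Nonempty S × (∃ λ v → v ∉ S) ×
    (∃ λ u → u ∉ S × ClassSize S u k) ×
    (∀ u c → u ∉ S → ClassSize S u c → k ≤ c)

  -- msad_k(G) = m, where "nothing" encodes ∞
  MsadIs : ℕ → Maybe ℕ → Set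
  MsadIs k nothing  = ∀ S → ¬ IsMARS k S
  MsadIs k (just m) =
    (∃ λ S → IsMARS k S × ∣ S ∣ ≡ m) × (∀ S → IsMARS k S → m ≤ ∣ S ∣)

-- The complete binary tree T_d of height d, in heap numbering:
-- vertices 0 .. 2^(d+1) - 2, root 0, children of i are 2i+1 and 2i+2.
T : ℕ → Graph
T d = record
  { N   = 2 ^ suc d ∸ 1
  ; adj = λ u v → child (toℕ u) (toℕ v) ∨ child (toℕ v) (toℕ u)
  }
  where
  child : ℕ → ℕ → Bool
  child p c = (c ≡ᵇ 2 * p + 1) ∨ (c ≡ᵇ 2 * p + 2)

-- For d ≥ 4 the singleton {1} (1 is the left child of the root) is a 3-MARS. With a single
-- landmark, the class of a vertex v ∉ {1} is its level {w : d(w,1) = d(v,1)}; the level at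
-- distance 1 is {0, 3, 4}, and every level j ≤ d + 1 has at least three vertices (for j ≥ 4
-- the last three vertices of depth j − 1). Distances to 1 are certified by a breadth-first
-- labelling: zero only at 1, changing by at most one along edges, and decreasing by one
-- towards some neighbour of every other vertex. For d = 2 and d = 3 everything is finite and
-- decided by evaluation: no vertex set of T₂ is a 3-MARS, while in T₃ the set {0, 1} is one
-- and no singleton is.
module Submission where

open import Data.Bool.Base using (Bool; true; false; _∧_; _∨_; if_then_else_) renaming (T to IsTrue)
open import Data.Bool.ListAction using (any)
open import Data.Bool.Properties using (T-∧; T-∨; T-≡; ⇔→≡)
open import Data.Fin using (#_)
open import Data.Fin.Base using (Fin; toℕ; fromℕ<)
open import Data.Fin.Properties using (any?; all?; toℕ-fromℕ<; toℕ<n; toℕ-injective) renaming (_≟_ to _≟ᶠ_)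
open import Data.Fin.Subset using (Subset; _∈_; _∉_; ⁅_⁆; _∪_; ∣_∣; inside; outside)
open import Data.Fin.Subset.Properties
  using (_∈?_; nonempty?; anySubset?; x∈⁅x⁆; x∈⁅y⁆⇒x≡y; x∈p∪q⁻; x∈p∪q⁺; ∣⁅x⁆∣≡1; p⊆q⇒∣p∣≤∣q∣; Empty-unique)
open import Data.List.Base using (List; []; _∷_; _++_; length; filter; allFin)
open import Data.List.Membership.Propositional using (lose) renaming (_∈_ to _∈ˡ_)
open import Data.List.Membership.Propositional.Properties
  using (∈-allFin; ∈-filter⁺; ∈-filter⁻; ∈-∃++; ∈-++⁻; ∈-++⁺ˡ; ∈-++⁺ʳ)
open import Data.List.Properties using (length-++-sucʳ; filter-none; filter-some; filter-≐)
open import Data.List.Relation.Binary.Subset.Propositional using (_⊆_)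
open import Data.List.Relation.Unary.All as All using (All; []; _∷_)
open import Data.List.Relation.Unary.AllPairs using ([]; _∷_)
open import Data.List.Relation.Unary.Any using (here; there; satisfied)
open import Data.List.Relation.Unary.Any.Properties using (any⁺; any⁻)
open import Data.List.Relation.Unary.Unique.Propositional using (Unique)
open import Data.List.Relation.Unary.Unique.Propositional.Properties using (filter⁺; allFin⁺)
open import Data.Maybe.Base using (just; nothing)
open import Data.Nat.Base
open import Data.Nat.Induction using (<-rec; <-wellFounded)
open import Data.Nat.Properties
open import Data.Nat.Tactic.RingSolver using (solve-∀)
open import Data.Product using (∃-syntax; _×_; _,_; proj₁; proj₂)
open import Data.Sum as Sum using (_⊎_; inj₁; inj₂; swap)
open import Data.Vec.Base using (lookup; _∷_)
import Data.Vec.Base as Vec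
open import Data.Vec.Properties using (lookup∘tabulate; []=⇒lookup; lookup⇒[]=)
open import Function.Base using (_∘_)
open import Function.Bundles using (_⇔_; mk⇔; Equivalence)
open import Induction.WellFounded using (WfRec; module FixPoint)
open import Relation.Binary.PropositionalEquality
  using (_≡_; _≢_; refl; sym; trans; cong; cong₂; subst; subst₂; module ≡-Reasoning)
open import Relation.Nullary.Decidable
  using (Dec; yes; no; map′; _×-dec_; _→-dec_; ¬?; True; toWitness; toWitnessFalse)
open import Relation.Nullary.Negation using (¬_; contradiction)

open import Defs

open Equivalence using (to; from)

∈⇔lookup : ∀ {n x} {X : Subset n} → x ∈ X ⇔ lookup X x ≡ true
∈⇔lookup {x = x} {X} = mk⇔ []=⇒lookup (lookup⇒[]= x X)

∈⇔IsTrue : ∀ {n x} {X : Subset n} → x ∈ X ⇔ IsTrue (lookup X x)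
∈⇔IsTrue = mk⇔ (from T-≡ ∘ to ∈⇔lookup) (from ∈⇔lookup ∘ to T-≡)

x∈p⇒0<∣p∣ : ∀ {n} {p : Subset n} {x} → x ∈ p → 0 < ∣ p ∣
x∈p⇒0<∣p∣ {x = x} x∈p =
  subst (_≤ _) (∣⁅x⁆∣≡1 x) (p⊆q⇒∣p∣≤∣q∣ λ y∈⁅x⁆ → subst (_∈ _) (sym (x∈⁅y⁆⇒x≡y x y∈⁅x⁆)) x∈p)

∣p∣≤1⇒p≡⁅x⁆ : ∀ {n} {p : Subset n} {x} → x ∈ p → ∣ p ∣ ≤ 1 → p ≡ ⁅ x ⁆
∣p∣≤1⇒p≡⁅x⁆ {p = inside  ∷ p} Vec.here        (s≤s ∣p∣≤0) =
  cong (inside ∷_) (Empty-unique λ (_ , y∈p) → <⇒≱ (x∈p⇒0<∣p∣ y∈p) ∣p∣≤0)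
∣p∣≤1⇒p≡⁅x⁆ {p = inside  ∷ p} (Vec.there x∈p) (s≤s ∣p∣≤0) = contradiction ∣p∣≤0 (<⇒≱ (x∈p⇒0<∣p∣ x∈p))
∣p∣≤1⇒p≡⁅x⁆ {p = outside ∷ p} (Vec.there x∈p) ∣p∣≤1       = cong (outside ∷_) (∣p∣≤1⇒p≡⁅x⁆ x∈p ∣p∣≤1)

length-≤-⊆ : ∀ {A : Set} {xs ys : List A} → Unique xs → xs ⊆ ys → length xs ≤ length ys
length-≤-⊆ {xs = []}     _          _     = z≤n
length-≤-⊆ {xs = x ∷ xs} (x∉xs ∷ u) xs⊆ys
  with as , bs , refl ← ∈-∃++ (xs⊆ys (here refl))
  = subst (suc (length xs) ≤_) (sym (length-++-sucʳ as x bs)) (s≤s (length-≤-⊆ u xs⊆as++bs))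
  where
  xs⊆as++bs : xs ⊆ as ++ bs
  xs⊆as++bs {y} y∈xs with ∈-++⁻ as (xs⊆ys (there y∈xs))
  ... | inj₁ y∈as         = ∈-++⁺ˡ y∈as
  ... | inj₂ (here refl)  = contradiction refl (All.lookup x∉xs y∈xs)
  ... | inj₂ (there y∈bs) = ∈-++⁺ʳ as y∈bs

-- Distances via breadth-first balls

module Distance (G : Graph) where

  private
    n = N G
    V = Fin n

  _~_ : V → V → Set
  x ~ y = IsTrue (adj G x y)

  Reach : ℕ → V → V → Set
  Reach zero    u v = u ≡ v
  Reach (suc k) u v = Reach k u v ⊎ ∃[ x ] Reach k u x × x ~ v

  Reach-refl : ∀ k {u} → Reach k u u
  Reach-refl zero    = refl
  Reach-refl (suc k) = inj₁ (Reach-refl k)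

  Reach-cons : ∀ k {w u v} → w ~ u → Reach k u v → Reach (suc k) w v
  Reach-cons zero    {w} w~u refl                = inj₂ (w , refl , w~u)
  Reach-cons (suc k) w~u (inj₁ r)               = inj₁ (Reach-cons k w~u r)
  Reach-cons (suc k) w~u (inj₂ (x , r , x~v)) = inj₂ (x , Reach-cons k w~u r , x~v)

  lookup-neighbours : ∀ X w → lookup (neighbours G X) w ≡ any (λ x → lookup X x ∧ adj G x w) (allFin n)
  lookup-neighbours X w = lookup∘tabulate _ w

  ∈neighbours⁻ : ∀ {w X} → w ∈ neighbours G X → ∃[ x ] x ∈ X × x ~ w
  ∈neighbours⁻ {w} {X} w∈
    with x , x∧w ← satisfied (any⁻ _ (allFin n) (subst IsTrue (lookup-neighbours X w) (to ∈⇔IsTrue w∈)))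
    = x , from ∈⇔IsTrue (proj₁ (to T-∧ x∧w)) , proj₂ (to T-∧ x∧w)

  ∈neighbours⁺ : ∀ {x w X} → x ∈ X → x ~ w → w ∈ neighbours G X
  ∈neighbours⁺ {x} {w} {X} x∈ x~w = from ∈⇔IsTrue (subst IsTrue (sym (lookup-neighbours X w))
    (any⁺ _ (lose (∈-allFin x) (from T-∧ (to ∈⇔IsTrue x∈ , x~w)))))

  ∈ball⇒Reach : ∀ k {u v} → v ∈ ball G k u → Reach k u v
  ∈ball⇒Reach zero    v∈ = sym (x∈⁅y⁆⇒x≡y _ v∈)
  ∈ball⇒Reach (suc k) v∈ with x∈p∪q⁻ _ _ v∈
  ... | inj₁ v∈ball = inj₁ (∈ball⇒Reach k v∈ball)
  ... | inj₂ v∈nbrs with x , x∈ , x~v ← ∈neighbours⁻ v∈nbrs = inj₂ (x , ∈ball⇒Reach k x∈ , x~v)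

  Reach⇒∈ball : ∀ k {u v} → Reach k u v → v ∈ ball G k u
  Reach⇒∈ball zero    refl                 = x∈⁅x⁆ _
  Reach⇒∈ball (suc k) (inj₁ r)             = x∈p∪q⁺ (inj₁ (Reach⇒∈ball k r))
  Reach⇒∈ball (suc k) (inj₂ (x , r , x~v)) = x∈p∪q⁺ (inj₂ (∈neighbours⁺ (Reach⇒∈ball k r) x~v))

  search-≡ : ∀ f k {u v m} → k ≤ m → m < k + f →
             (∀ {j} → j < m → v ∉ ball G j u) → v ∈ ball G m u → search G f k u v ≡ m
  search-≡ zero    k k≤m m<k+0 _ _ = contradiction (≤-trans m<k+0 (≤-reflexive (+-identityʳ k))) (≤⇒≯ k≤m)
  search-≡ (suc f) k {u} {v} {m} k≤m m<k+1+f not-yet reached with lookup (ball G k u) v in eq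
  ... | true  = ≤-antisym k≤m (≮⇒≥ λ k<m → not-yet k<m (from ∈⇔lookup eq))
  ... | false = search-≡ f (suc k) (≤∧≢⇒< k≤m k≢m) (subst (m <_) (+-suc k f) m<k+1+f) not-yet reached
    where
    k≢m : k ≢ m
    k≢m refl = contradiction (trans (sym eq) (to ∈⇔lookup reached)) λ ()

  search-≤ : ∀ f k u v → search G f k u v ≤ k + f
  search-≤ zero    k u v = ≤-reflexive (sym (+-identityʳ k))
  search-≤ (suc f) k u v with lookup (ball G k u) v
  ... | true  = m≤m+n k (suc f)
  ... | false = subst (search G f (suc k) u v ≤_) (sym (+-suc k f)) (search-≤ f (suc k) u v)

  dist≤n : ∀ u v → dist G u v ≤ n
  dist≤n = search-≤ n 0

  module _ (~-sym : ∀ {x y} → x ~ y → y ~ x) where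

    Reach-sym : ∀ k {u v} → Reach k u v → Reach k v u
    Reach-sym zero    refl                 = refl
    Reach-sym (suc k) (inj₁ r)             = inj₁ (Reach-sym k r)
    Reach-sym (suc k) (inj₂ (x , r , x~v)) = Reach-cons k (~-sym x~v) (Reach-sym k r)

    lookup-ball-sym : ∀ k u v → lookup (ball G k u) v ≡ lookup (ball G k v) u
    lookup-ball-sym k u v = ⇔→≡ (mk⇔ (flip u v) (flip v u))
      where
      flip : ∀ u v → lookup (ball G k u) v ≡ true → lookup (ball G k v) u ≡ true
      flip u v = to ∈⇔lookup ∘ Reach⇒∈ball k ∘ Reach-sym k ∘ ∈ball⇒Reach k ∘ from ∈⇔lookup

    search-sym : ∀ f k u v → search G f k u v ≡ search G f k v u
    search-sym zero    k u v = refl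
    search-sym (suc f) k u v =
      cong₂ (λ b r → if b then k else r) (lookup-ball-sym k u v) (search-sym f (suc k) u v)

    dist-sym : ∀ u v → dist G u v ≡ dist G v u
    dist-sym = search-sym n 0

  record IsDistanceFrom (c : V) (h : V → ℕ) : Set where
    field
      at-centre : h c ≡ 0
      lipschitz : ∀ {x y} → x ~ y → h y ≤ suc (h x)
      parent    : ∀ v → v ≢ c → ∃[ w ] w ~ v × suc (h w) ≡ h v
      bounded   : ∀ v → h v < n

    Reach⇒≤ : ∀ k {v} → Reach k c v → h v ≤ k
    Reach⇒≤ zero    refl                 = ≤-reflexive at-centre
    Reach⇒≤ (suc k) (inj₁ r)             = m≤n⇒m≤1+n (Reach⇒≤ k r)
    Reach⇒≤ (suc k) (inj₂ (x , r , x~v)) = ≤-trans (lipschitz x~v) (s≤s (Reach⇒≤ k r))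

    ≤⇒Reach : ∀ k v → h v ≤ k → Reach k c v
    ≤⇒Reach k v hv≤k with v ≟ᶠ c
    ... | yes refl = Reach-refl k
    ≤⇒Reach zero    v hv≤0 | no v≢c with w , _ , 1+hw≡hv ← parent v v≢c
      = contradiction (subst (_≤ 0) (sym 1+hw≡hv) hv≤0) λ ()
    ≤⇒Reach (suc k) v hv≤k | no v≢c with w , w~v , 1+hw≡hv ← parent v v≢c
      = inj₂ (w , ≤⇒Reach k w (s≤s⁻¹ (subst (_≤ suc k) (sym 1+hw≡hv) hv≤k)) , w~v)

    dist≡ : ∀ v → dist G c v ≡ h v
    dist≡ v = search-≡ n 0 z≤n (bounded v)
      (λ j<hv v∈ → <⇒≱ j<hv (Reach⇒≤ _ (∈ball⇒Reach _ v∈)))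
      (Reach⇒∈ball _ (≤⇒Reach _ v ≤-refl))

-- Multisets of distances and their classes

multWith : ∀ {n} → (Fin n → Fin n → ℕ) → Subset n → Fin n → ℕ → ℕ
multWith {n} δ S v j = length (filter (λ s → (s ∈? S) ×-dec (δ v s ≟ j)) (allFin n))

multWith-cong : ∀ {n} (δ δ′ : Fin n → Fin n → ℕ) {S u v} →
                (∀ {s} → s ∈ S → δ u s ≡ δ′ v s) → ∀ j → multWith δ S u j ≡ multWith δ′ S v j
multWith-cong {n} _ _ eq j = cong length (filter-≐ _ _
  ((λ {s} (s∈S , e) → s∈S , trans (sym (eq s∈S)) e) , (λ {s} (s∈S , e) → s∈S , trans (eq s∈S) e)) (allFin n))

module Classes (G : Graph) where

  private
    n = N G

  n<j⇒mult≡0 : ∀ S v {j} → n < j → mult G S v j ≡ 0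
  n<j⇒mult≡0 S v {j} n<j = cong length (filter-none _ {xs = allFin n}
    (All.universal (λ s (_ , vs≡j) → <⇒≱ n<j (subst (_≤ n) vs≡j (Distance.dist≤n G v s))) _))

  0<mult-⁅⁆⇔ : ∀ {s v j} → 0 < mult G ⁅ s ⁆ v j ⇔ dist G v s ≡ j
  0<mult-⁅⁆⇔ {s} {v} {j} = mk⇔ from-mult (λ vs≡j → filter-some _ (lose (∈-allFin s) (x∈⁅x⁆ s , vs≡j)))
    where
    from-mult : 0 < mult G ⁅ s ⁆ v j → dist G v s ≡ j
    from-mult 0<m with dist G v s ≟ j
    ... | yes vs≡j = vs≡j
    ... | no  vs≢j = contradiction (cong length (filter-none _ {xs = allFin n} (All.universal
          (λ t (t∈⁅s⁆ , vt≡j) → vs≢j (subst (λ t → dist G v t ≡ j) (x∈⁅y⁆⇒x≡y s t∈⁅s⁆) vt≡j)) _))) (>⇒≢ 0<m)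

  SameMultiset-⁅⁆⇔ : ∀ {s u v} → SameMultiset G ⁅ s ⁆ u v ⇔ dist G u s ≡ dist G v s
  SameMultiset-⁅⁆⇔ {s} {u} {v} = mk⇔
    (λ same → sym (to 0<mult-⁅⁆⇔ (subst (0 <_) (same _) (from 0<mult-⁅⁆⇔ refl))))
    (λ eq → multWith-cong (dist G) (dist G) λ t∈⁅s⁆ →
              subst (λ t → dist G u t ≡ dist G v t) (sym (x∈⁅y⁆⇒x≡y s t∈⁅s⁆)) eq)

  ClassSize-unique : ∀ {S u c c′} → ClassSize G S u c → ClassSize G S u c′ → c ≡ c′
  ClassSize-unique (l , l! , refl , ∈l⇔) (l′ , l′! , refl , ∈l′⇔) = ≤-antisym
    (length-≤-⊆ l!  (λ {v} → from (∈l′⇔ v) ∘ to (∈l⇔ v)))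
    (length-≤-⊆ l′! (λ {v} → from (∈l⇔ v) ∘ to (∈l′⇔ v)))

  singleton-MARS⇒msad≡1 : ∀ {k x} → IsMARS G k ⁅ x ⁆ → MsadIs G k (just 1)
  singleton-MARS⇒msad≡1 {x = x} mars = (⁅ x ⁆ , mars , ∣⁅x⁆∣≡1 x) , λ S ((y , y∈S) , _) → x∈p⇒0<∣p∣ y∈S

  no-singleton-MARS⇒msad≡2 : ∀ {k S} → IsMARS G k S → ∣ S ∣ ≡ 2 → (∀ x → ¬ IsMARS G k ⁅ x ⁆) →
                             MsadIs G k (just 2)
  no-singleton-MARS⇒msad≡2 {k} {S} mars ∣S∣≡2 no-singleton = (S , mars , ∣S∣≡2) , at-least-two
    where
    at-least-two : ∀ S → IsMARS G k S → 2 ≤ ∣ S ∣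
    at-least-two S mars@((x , x∈S) , _) with 2 ≤? ∣ S ∣
    ... | yes 2≤∣S∣ = 2≤∣S∣
    ... | no  2≰∣S∣ =
      contradiction (subst (IsMARS G k) (∣p∣≤1⇒p≡⁅x⁆ x∈S (s≤s⁻¹ (≰⇒> 2≰∣S∣))) mars) (no-singleton x)

-- D only serves to make the decision procedure fast to evaluate; any D agreeing with dist will do.

module Decision (G : Graph) (D : Fin (N G) → Fin (N G) → ℕ) (D≡dist : ∀ u v → D u v ≡ dist G u v) where

  private
    n = N G
    V = Fin n

  open Classes G

  multD≡mult : ∀ S v j → multWith D S v j ≡ mult G S v j
  multD≡mult S v = multWith-cong D (dist G) λ {s} _ → D≡dist v s

  sameMultiset? : ∀ S u v → Dec (SameMultiset G S u v)
  sameMultiset? S u v =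
    map′ bounded⇒all all⇒bounded (allUpTo? (λ j → multWith D S u j ≟ multWith D S v j) (suc n))
    where
    all⇒bounded : SameMultiset G S u v → ∀ {j} → j < suc n → multWith D S u j ≡ multWith D S v j
    all⇒bounded same {j} _ = trans (multD≡mult S u j) (trans (same j) (sym (multD≡mult S v j)))
    bounded⇒all : (∀ {j} → j < suc n → multWith D S u j ≡ multWith D S v j) → SameMultiset G S u v
    bounded⇒all same j with j ≤? n
    ... | yes j≤n = trans (sym (multD≡mult S u j)) (trans (same (s≤s j≤n)) (multD≡mult S v j))
    ... | no  j≰n = trans (n<j⇒mult≡0 S u (≰⇒> j≰n)) (sym (n<j⇒mult≡0 S v (≰⇒> j≰n)))

  class : Subset n → V → List V
  class S u = filter (λ v → ¬? (v ∈? S) ×-dec sameMultiset? S v u) (allFin n)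

  ClassSize-class : ∀ S u → ClassSize G S u (length (class S u))
  ClassSize-class S u = class S u , filter⁺ _ (allFin⁺ n) , refl , λ v →
    mk⇔ (proj₂ ∘ ∈-filter⁻ _ {xs = allFin n}) (∈-filter⁺ _ (∈-allFin v))

  isMARS? : ∀ k S → Dec (IsMARS G k S)
  isMARS? k S = map′
    (λ (ne , out , (u , u∉S , size≡k) , min) → ne , out ,
       (u , u∉S , subst (ClassSize G S u) size≡k (ClassSize-class S u)) ,
       λ w c w∉S w-size → subst (k ≤_) (ClassSize-unique (ClassSize-class S w) w-size) (min w w∉S))
    (λ (ne , out , (u , u∉S , u-size) , min) → ne , out ,
       (u , u∉S , ClassSize-unique (ClassSize-class S u) u-size) ,
       λ w w∉S → min w _ w∉S (ClassSize-class S w))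
    (nonempty? S ×-dec any? (λ v → ¬? (v ∈? S)) ×-dec
     any? (λ u → ¬? (u ∈? S) ×-dec length (class S u) ≟ k) ×-dec
     all? (λ u → ¬? (u ∈? S) →-dec k ≤? length (class S u)))

-- Heap numbering

_isChildOf_ : ℕ → ℕ → Set
c isChildOf p = c ≡ 2 * p + 1 ⊎ c ≡ 2 * p + 2

2+[2p+i]≡2[1+p]+i : ∀ p i → 2 + (2 * p + i) ≡ 2 * suc p + i
2+[2p+i]≡2[1+p]+i = solve-∀

parent-isChildOf : ∀ w → suc (suc w) isChildOf ⌊ suc w /2⌋
parent-isChildOf zero          = inj₂ refl
parent-isChildOf (suc zero)    = inj₁ refl
parent-isChildOf (suc (suc w)) with parent-isChildOf w
... | inj₁ eq = inj₁ (trans (cong (2 +_) eq) (2+[2p+i]≡2[1+p]+i _ 1))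
... | inj₂ eq = inj₂ (trans (cong (2 +_) eq) (2+[2p+i]≡2[1+p]+i _ 2))

⌊n/2⌋<m : ∀ {n m} → n < m + m → ⌊ n /2⌋ < m
⌊n/2⌋<m {n} {m} n<m+m = ≤-trans (⌊n/2⌋-mono (s≤s n<m+m)) (≤-reflexive (sym (n≡⌈n+n/2⌉ m)))

3+n≤2^[1+n] : ∀ {n} → 1 ≤ n → 3 + n ≤ 2 ^ suc n
3+n≤2^[1+n] {suc zero}    _ = ≤-refl
3+n≤2^[1+n] {suc (suc n)} _ = begin
  suc (3 + suc n)    ≤⟨ +-mono-≤ (m^n>0 2 (2 + n)) (3+n≤2^[1+n] (s≤s z≤n)) ⟩
  2^[2+n] + 2^[2+n]  ≡⟨ cong (2^[2+n] +_) (+-identityʳ 2^[2+n]) ⟨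
  2 ^ (3 + n)        ∎
  where
  open ≤-Reasoning
  2^[2+n] = 2 ^ (2 + n)

-- distFrom₁ v is the distance from vertex 1 to v in the heap-numbered infinite binary tree:
-- the parent of v + 2 is ⌊(v + 1)/2⌋, and 0 is adjacent to 1.
private
  distFrom₁-step : ∀ v → WfRec _<_ (λ _ → ℕ) v → ℕ
  distFrom₁-step zero          _   = 1
  distFrom₁-step (suc zero)    _   = 0
  distFrom₁-step (suc (suc w)) rec = suc (rec (m<n⇒m<1+n (⌊n/2⌋<n w)))

  distFrom₁-step-ext : ∀ v {rec rec′ : WfRec _<_ (λ _ → ℕ) v} →
                       (∀ {w} (w<v : w < v) → rec w<v ≡ rec′ w<v) → distFrom₁-step v rec ≡ distFrom₁-step v rec′
  distFrom₁-step-ext zero          _  = refl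
  distFrom₁-step-ext (suc zero)    _  = refl
  distFrom₁-step-ext (suc (suc w)) eq = cong suc (eq _)

distFrom₁ : ℕ → ℕ
distFrom₁ = <-rec (λ _ → ℕ) distFrom₁-step

distFrom₁-parent : ∀ w → distFrom₁ (suc (suc w)) ≡ suc (distFrom₁ ⌊ suc w /2⌋)
distFrom₁-parent w =
  FixPoint.unfold-wfRec <-wellFounded (λ _ → ℕ) distFrom₁-step distFrom₁-step-ext {suc (suc w)}

distFrom₁-right : ∀ p → distFrom₁ (2 * p + 2) ≡ suc (distFrom₁ p)
distFrom₁-right p = begin
  distFrom₁ (2 * p + 2)              ≡⟨ cong distFrom₁ (2p+2≡2+[p+p] p) ⟩
  distFrom₁ (2 + (p + p))            ≡⟨ distFrom₁-parent (p + p) ⟩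
  suc (distFrom₁ ⌊ suc (p + p) /2⌋)  ≡⟨ cong (suc ∘ distFrom₁) (n≡⌈n+n/2⌉ p) ⟨
  suc (distFrom₁ p)                  ∎
  where
  open ≡-Reasoning
  2p+2≡2+[p+p] : ∀ p → 2 * p + 2 ≡ 2 + (p + p)
  2p+2≡2+[p+p] = solve-∀

distFrom₁-left : ∀ p → distFrom₁ (2 * suc p + 1) ≡ suc (distFrom₁ (suc p))
distFrom₁-left p = begin
  distFrom₁ (2 * suc p + 1)          ≡⟨ cong distFrom₁ (2[1+p]+1≡2+[1+p+p] p) ⟩
  distFrom₁ (2 + (suc p + p))        ≡⟨ distFrom₁-parent (suc p + p) ⟩
  suc (distFrom₁ (suc ⌊ p + p /2⌋))  ≡⟨ cong (suc ∘ distFrom₁ ∘ suc) (n≡⌊n+n/2⌋ p) ⟨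
  suc (distFrom₁ (suc p))            ∎
  where
  open ≡-Reasoning
  2[1+p]+1≡2+[1+p+p] : ∀ p → 2 * suc p + 1 ≡ 2 + (suc p + p)
  2[1+p]+1≡2+[1+p+p] = solve-∀

private
  ≡suc⇒≤suc×≤suc : ∀ {x y} → x ≡ suc y → x ≤ suc y × y ≤ suc x
  ≡suc⇒≤suc×≤suc refl = ≤-refl , m≤n⇒m≤1+n (n≤1+n _)

distFrom₁-edge : ∀ {c p} → c isChildOf p → distFrom₁ c ≤ suc (distFrom₁ p) × distFrom₁ p ≤ suc (distFrom₁ c)
distFrom₁-edge {p = zero}  (inj₁ refl) = z≤n , ≤-refl
distFrom₁-edge {p = suc p} (inj₁ refl) = ≡suc⇒≤suc×≤suc (distFrom₁-left p)
distFrom₁-edge {p = p}     (inj₂ refl) = ≡suc⇒≤suc×≤suc (distFrom₁-right p)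

distFrom₁-≤ : ∀ k v → suc v < 2 ^ suc k → distFrom₁ v ≤ suc k
distFrom₁-≤ k       zero          _  = s≤s z≤n
distFrom₁-≤ k       (suc zero)    _  = z≤n
distFrom₁-≤ zero    (suc (suc w)) (s≤s (s≤s ()))
distFrom₁-≤ (suc k) (suc (suc w)) lt = begin
  distFrom₁ (suc (suc w))      ≡⟨ distFrom₁-parent w ⟩
  suc (distFrom₁ ⌊ suc w /2⌋)  ≤⟨ s≤s (distFrom₁-≤ k _ (⌊n/2⌋<m parent-bound)) ⟩
  suc (suc k)                  ∎
  where
  open ≤-Reasoning
  parent-bound : 3 + w < 2 ^ suc k + 2 ^ suc k
  parent-bound = subst (3 + w <_) (cong (2 ^ suc k +_) (+-identityʳ _)) lt

distFrom₁≡0⇒≡1 : ∀ v → distFrom₁ v ≡ 0 → v ≡ 1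
distFrom₁≡0⇒≡1 (suc zero)    _  = refl
distFrom₁≡0⇒≡1 (suc (suc w)) eq = contradiction (trans (sym (distFrom₁-parent w)) eq) λ ()

distFrom₁≡1 : ∀ v → distFrom₁ v ≡ 1 → v ≡ 0 ⊎ v isChildOf 1
distFrom₁≡1 zero          _  = inj₁ refl
distFrom₁≡1 (suc (suc w)) eq = inj₂ (subst (suc (suc w) isChildOf_) p≡1 (parent-isChildOf w))
  where p≡1 = distFrom₁≡0⇒≡1 _ (suc-injective (trans (sym (distFrom₁-parent w)) eq))

-- rightmost k, 1 + rightmost k and 2 + rightmost k are the last three vertices of depth k + 3.
rightmost : ℕ → ℕ
rightmost zero    = 12
rightmost (suc k) = 2 * suc (rightmost k) + 2

rightmost-level : ∀ k → distFrom₁ (rightmost k) ≡ 4 + k ×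
                        distFrom₁ (1 + rightmost k) ≡ 4 + k × distFrom₁ (2 + rightmost k) ≡ 4 + k
rightmost-level zero    = refl , refl , refl
rightmost-level (suc k) with _ , r₁ , r₂ ← rightmost-level k =
  trans (distFrom₁-right (suc r)) (cong suc r₁) ,
  trans (cong distFrom₁ (1+[2p+2]≡2[1+p]+1 (suc r))) (trans (distFrom₁-left (suc r)) (cong suc r₂)) ,
  trans (cong distFrom₁ (2+[2p+i]≡2[1+p]+i (suc r) 2)) (trans (distFrom₁-right (2 + r)) (cong suc r₂))
  where
  r = rightmost k
  1+[2p+2]≡2[1+p]+1 : ∀ p → 1 + (2 * p + 2) ≡ 2 * suc p + 1
  1+[2p+2]≡2[1+p]+1 = solve-∀

rightmost-bound : ∀ k → 4 + rightmost k ≡ 2 ^ (4 + k)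
rightmost-bound zero    = refl
rightmost-bound (suc k) = trans (4+[2[1+r]+2]≡2[4+r] (rightmost k)) (cong (2 *_) (rightmost-bound k))
  where
  4+[2[1+r]+2]≡2[4+r] : ∀ r → 4 + (2 * suc r + 2) ≡ 2 * (4 + r)
  4+[2[1+r]+2]≡2[4+r] = solve-∀

-- The tree T_d

isChildOfᵇ : ℕ → ℕ → Bool
isChildOfᵇ c p = (c ≡ᵇ 2 * p + 1) ∨ (c ≡ᵇ 2 * p + 2)

isChildOf⇔ : ∀ c p → IsTrue (isChildOfᵇ c p) ⇔ c isChildOf p
isChildOf⇔ c p = mk⇔
  (Sum.map (≡ᵇ⇒≡ c _) (≡ᵇ⇒≡ c _) ∘ to T-∨)
  (from T-∨ ∘ Sum.map (≡⇒≡ᵇ c _) (≡⇒≡ᵇ c _))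

adj-T⇔ : ∀ d (u v : Fin (N (T d))) →
         IsTrue (adj (T d) u v) ⇔ (toℕ v isChildOf toℕ u ⊎ toℕ u isChildOf toℕ v)
adj-T⇔ d u v = mk⇔
  (Sum.map (to (isChildOf⇔ (toℕ v) (toℕ u))) (to (isChildOf⇔ (toℕ u) (toℕ v))) ∘ to T-∨)
  (from T-∨ ∘ Sum.map (from (isChildOf⇔ (toℕ v) (toℕ u))) (from (isChildOf⇔ (toℕ u) (toℕ v))))

adj-T-sym : ∀ d {u v : Fin (N (T d))} → IsTrue (adj (T d) u v) → IsTrue (adj (T d) v u)
adj-T-sym d {u} {v} = from (adj-T⇔ d v u) ∘ swap ∘ to (adj-T⇔ d u v)

module DistanceToVertex₁ (d : ℕ) (1≤d : 1 ≤ d) where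

  private
    V = Fin (N (T d))

  open Distance (T d) using (_~_; IsDistanceFrom; dist-sym)
  open Classes (T d) using (SameMultiset-⁅⁆⇔)

  vertex : ∀ m → suc m < 2 ^ suc d → V
  vertex m bound = fromℕ< (<⇒≤pred bound)

  toℕ-vertex : ∀ m bound → toℕ (vertex m bound) ≡ m
  toℕ-vertex m bound = toℕ-fromℕ< (<⇒≤pred bound)

  toℕ≡⇒≡vertex : ∀ {v m} bound → toℕ v ≡ m → v ≡ vertex m bound
  toℕ≡⇒≡vertex {m = m} bound v≡m = toℕ-injective (trans v≡m (sym (toℕ-vertex m bound)))

  toℕ-bound : ∀ (v : V) → suc (toℕ v) < 2 ^ suc d
  toℕ-bound v = pred-cancel-< (toℕ<n v)

  vertex₁-bound : 2 < 2 ^ suc d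
  vertex₁-bound = ≤-trans (n≤1+n 3) (^-monoʳ-≤ 2 (s≤s 1≤d))

  vertex₁ : V
  vertex₁ = vertex 1 vertex₁-bound

  toℕ-vertex₁ : toℕ vertex₁ ≡ 1
  toℕ-vertex₁ = toℕ-vertex 1 vertex₁-bound

  distFrom₁-isDistance : IsDistanceFrom vertex₁ (distFrom₁ ∘ toℕ)
  distFrom₁-isDistance = record
    { at-centre = cong distFrom₁ toℕ-vertex₁
    ; lipschitz = lipschitz
    ; parent    = λ v v≢vertex₁ → parent v v≢vertex₁ (toℕ v) refl
    ; bounded   = λ v → <-≤-trans (s≤s (distFrom₁-≤ d (toℕ v) (toℕ-bound v))) depth-bound
    }
    where
    lipschitz : ∀ {u v} → u ~ v → distFrom₁ (toℕ v) ≤ suc (distFrom₁ (toℕ u))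
    lipschitz {u} {v} u~v with to (adj-T⇔ d u v) u~v
    ... | inj₁ v◁u = proj₁ (distFrom₁-edge v◁u)
    ... | inj₂ u◁v = proj₂ (distFrom₁-edge u◁v)
    depth-bound : suc (suc d) ≤ 2 ^ suc d ∸ 1
    depth-bound = <⇒≤pred (3+n≤2^[1+n] 1≤d)
    parent : ∀ v → v ≢ vertex₁ → ∀ m → toℕ v ≡ m →
             ∃[ w ] w ~ v × suc (distFrom₁ (toℕ w)) ≡ distFrom₁ (toℕ v)
    parent v v≢vertex₁ zero          v≡0 =
      vertex₁ , from (adj-T⇔ d vertex₁ v) (inj₂ (inj₁ (trans toℕ-vertex₁ (cong (λ m → 2 * m + 1) (sym v≡0))))) ,
      trans (cong (suc ∘ distFrom₁) toℕ-vertex₁) (cong distFrom₁ (sym v≡0))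
    parent v v≢vertex₁ (suc zero)    v≡1 = contradiction (toℕ≡⇒≡vertex vertex₁-bound v≡1) v≢vertex₁
    parent v v≢vertex₁ (suc (suc w)) v≡2+w =
      vertex p p-bound ,
      from (adj-T⇔ d (vertex p p-bound) v)
        (inj₁ (subst₂ _isChildOf_ (sym v≡2+w) (sym (toℕ-vertex p p-bound)) (parent-isChildOf w))) ,
      trans (cong (suc ∘ distFrom₁) (toℕ-vertex p p-bound))
            (trans (sym (distFrom₁-parent w)) (cong distFrom₁ (sym v≡2+w)))
      where
      p = ⌊ suc w /2⌋
      p-bound : suc p < 2 ^ suc d
      p-bound = <-trans (s<s (m<n⇒m<1+n (⌊n/2⌋<n w))) (subst (λ m → suc m < 2 ^ suc d) v≡2+w (toℕ-bound v))

  dist-vertex₁ : ∀ v → dist (T d) v vertex₁ ≡ distFrom₁ (toℕ v)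
  dist-vertex₁ v =
    trans (dist-sym (λ {x} {y} → adj-T-sym d {x} {y}) v vertex₁) (IsDistanceFrom.dist≡ distFrom₁-isDistance v)

  ∈⁅vertex₁⁆⇔ : ∀ {v} → v ∈ ⁅ vertex₁ ⁆ ⇔ distFrom₁ (toℕ v) ≡ 0
  ∈⁅vertex₁⁆⇔ {v} = mk⇔
    (λ v∈ → trans (cong (distFrom₁ ∘ toℕ) (x∈⁅y⁆⇒x≡y vertex₁ v∈)) (cong distFrom₁ toℕ-vertex₁))
    (λ h≡0 → subst (_∈ ⁅ vertex₁ ⁆) (sym (toℕ≡⇒≡vertex vertex₁-bound (distFrom₁≡0⇒≡1 _ h≡0))) (x∈⁅x⁆ vertex₁))

  ∈class⇔ : ∀ {u v} → u ∉ ⁅ vertex₁ ⁆ →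
            (v ∉ ⁅ vertex₁ ⁆ × SameMultiset (T d) ⁅ vertex₁ ⁆ v u) ⇔ distFrom₁ (toℕ v) ≡ distFrom₁ (toℕ u)
  ∈class⇔ {u} {v} u∉ = mk⇔
    (λ (_ , same) → trans (sym (dist-vertex₁ v)) (trans (to SameMultiset-⁅⁆⇔ same) (dist-vertex₁ u)))
    (λ eq → (λ v∈ → u∉ (from ∈⁅vertex₁⁆⇔ (trans (sym eq) (to ∈⁅vertex₁⁆⇔ v∈)))) ,
            from SameMultiset-⁅⁆⇔ (trans (dist-vertex₁ v) (trans eq (sym (dist-vertex₁ u)))))

  record LevelTriple (j : ℕ) : Set where
    field
      a b c   : ℕ
      a<b     : a < b
      b<c     : b < c
      c-bound : suc c < 2 ^ suc d
      level   : distFrom₁ a ≡ j × distFrom₁ b ≡ j × distFrom₁ c ≡ j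

    private
      b-bound = <-trans (s<s b<c) c-bound
      a-bound = <-trans (s<s a<b) b-bound

    vertices : List V
    vertices = vertex a a-bound ∷ vertex b b-bound ∷ vertex c c-bound ∷ []

    vertices-unique : Unique vertices
    vertices-unique =
      (≢ a<b a-bound b-bound ∷ ≢ (<-trans a<b b<c) a-bound c-bound ∷ []) ∷ (≢ b<c b-bound c-bound ∷ []) ∷ [] ∷ []
      where
      ≢ : ∀ {m m′} → m < m′ → ∀ bound bound′ → vertex m bound ≢ vertex m′ bound′
      ≢ {m} {m′} m<m′ bound bound′ eq =
        <⇒≢ m<m′ (trans (sym (toℕ-vertex m bound)) (trans (cong toℕ eq) (toℕ-vertex m′ bound′)))

    vertices-level : All (λ v → distFrom₁ (toℕ v) ≡ j) vertices
    vertices-level with a-level , b-level , c-level ← level =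
      trans (cong distFrom₁ (toℕ-vertex a a-bound)) a-level ∷
      trans (cong distFrom₁ (toℕ-vertex b b-bound)) b-level ∷
      trans (cong distFrom₁ (toℕ-vertex c c-bound)) c-level ∷ []

module Vertex₁-MARS (d : ℕ) (4≤d : 4 ≤ d) where

  open DistanceToVertex₁ d (≤-trans (s≤s z≤n) 4≤d)

  private
    V = Fin (N (T d))

  small-bound : ∀ m {m≤30 : True (m ≤? 30)} → suc m < 2 ^ suc d
  small-bound m {m≤30} = ≤-trans (s≤s (s≤s (toWitness m≤30))) (^-monoʳ-≤ 2 (s≤s 4≤d))

  level-triple : ∀ j → 1 ≤ j → j ≤ suc d → LevelTriple j
  level-triple 1 _ _ = record
    { a = 0 ; b = 3 ; c = 4 ; a<b = z<s ; b<c = n<1+n 3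
    ; c-bound = small-bound 4 ; level = refl , refl , refl }
  level-triple 2 _ _ = record
    { a = 2 ; b = 7 ; c = 8 ; a<b = s<s (s<s z<s) ; b<c = n<1+n 7
    ; c-bound = small-bound 8 ; level = refl , refl , refl }
  level-triple 3 _ _ = record
    { a = 15 ; b = 16 ; c = 17 ; a<b = n<1+n 15 ; b<c = n<1+n 16
    ; c-bound = small-bound 17 ; level = refl , refl , refl }
  level-triple (suc (suc (suc (suc k)))) _ 4+k≤1+d = record
    { a = rightmost k ; b = 1 + rightmost k ; c = 2 + rightmost k
    ; a<b = n<1+n _ ; b<c = n<1+n _
    ; c-bound = subst (_≤ 2 ^ suc d) (sym (rightmost-bound k)) (^-monoʳ-≤ 2 4+k≤1+d)
    ; level = rightmost-level k
    }

  root : V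
  root = vertex 0 (small-bound 0)

  distFrom₁-root : distFrom₁ (toℕ root) ≡ 1
  distFrom₁-root = cong distFrom₁ (toℕ-vertex 0 (small-bound 0))

  root∉⁅vertex₁⁆ : root ∉ ⁅ vertex₁ ⁆
  root∉⁅vertex₁⁆ root∈ = contradiction (trans (sym distFrom₁-root) (to ∈⁅vertex₁⁆⇔ root∈)) λ ()

  root-class : ClassSize (T d) ⁅ vertex₁ ⁆ root 3
  root-class = vertices , vertices-unique , refl , λ v → mk⇔
    (λ v∈ → from (∈class⇔ root∉⁅vertex₁⁆) (trans (All.lookup vertices-level v∈) (sym distFrom₁-root)))
    (λ v∈class → level-1-member (distFrom₁≡1 _ (trans (to (∈class⇔ root∉⁅vertex₁⁆) v∈class) distFrom₁-root)))
    where
    open LevelTriple (level-triple 1 (s≤s z≤n) (s≤s z≤n))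
    level-1-member : ∀ {v} → toℕ v ≡ 0 ⊎ toℕ v isChildOf 1 → v ∈ˡ vertices
    level-1-member (inj₁ v≡0)        = here (toℕ≡⇒≡vertex (small-bound 0) v≡0)
    level-1-member (inj₂ (inj₁ v≡3)) = there (here (toℕ≡⇒≡vertex (small-bound 3) v≡3))
    level-1-member (inj₂ (inj₂ v≡4)) = there (there (here (toℕ≡⇒≡vertex (small-bound 4) v≡4)))

  class-≥3 : ∀ u c → u ∉ ⁅ vertex₁ ⁆ → ClassSize (T d) ⁅ vertex₁ ⁆ u c → 3 ≤ c
  class-≥3 u c u∉ (l , _ , refl , ∈l⇔) =
    length-≤-⊆ vertices-unique (λ v∈ → from (∈l⇔ _) (from (∈class⇔ u∉) (All.lookup vertices-level v∈)))
    where
    open LevelTriple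
      (level-triple (distFrom₁ (toℕ u)) (n≢0⇒n>0 (u∉ ∘ from ∈⁅vertex₁⁆⇔)) (distFrom₁-≤ d _ (toℕ-bound u)))

  ⁅vertex₁⁆-isMARS : IsMARS (T d) 3 ⁅ vertex₁ ⁆
  ⁅vertex₁⁆-isMARS =
    (vertex₁ , x∈⁅x⁆ vertex₁) , (root , root∉⁅vertex₁⁆) , (root , root∉⁅vertex₁⁆ , root-class) , class-≥3

-- The small trees

-- Distance between heap indices, found by moving the larger index to its parent; 2d steps
-- suffice in T_d. Unlike dist it is fast enough to evaluate in the exhaustive searches below.
heapDist : (fuel u v : ℕ) → ℕ
heapDist zero    u v = 0
heapDist (suc f) u v with compare u v
... | less    u k = suc (heapDist f u ⌊ u + k /2⌋)
... | equal   u   = 0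
... | greater v k = suc (heapDist f ⌊ v + k /2⌋ v)

heapDist-T : ∀ d → Fin (N (T d)) → Fin (N (T d)) → ℕ
heapDist-T d u v = heapDist (2 * d) (toℕ u) (toℕ v)

heapDist-T₂ : ∀ u v → heapDist-T 2 u v ≡ dist (T 2) u v
heapDist-T₂ = toWitness {a? = all? λ u → all? λ v → heapDist-T 2 u v ≟ dist (T 2) u v} _

heapDist-T₃ : ∀ u v → heapDist-T 3 u v ≡ dist (T 3) u v
heapDist-T₃ = toWitness {a? = all? λ u → all? λ v → heapDist-T 3 u v ≟ dist (T 3) u v} _

module T₂ = Decision (T 2) (heapDist-T 2) heapDist-T₂
module T₃ = Decision (T 3) (heapDist-T 3) heapDist-T₃

msad₃-T₂ : MsadIs (T 2) 3 nothing
msad₃-T₂ S S-isMARS = toWitnessFalse {a? = anySubset? (T₂.isMARS? 3)} _ (S , S-isMARS)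

msad₃-T₃ : MsadIs (T 3) 3 (just 2)
msad₃-T₃ = Classes.no-singleton-MARS⇒msad≡2 (T 3)
  (toWitness {a? = T₃.isMARS? 3 (⁅ # 0 ⁆ ∪ ⁅ # 1 ⁆)} _) refl
  (toWitness {a? = all? λ x → ¬? (T₃.isMARS? 3 ⁅ x ⁆)} _)

proposition15 : ∀ (d : ℕ) → 2 ≤ d →
    (d ≡ 2 → MsadIs (T d) 3 nothing) ×
    (d ≡ 3 → MsadIs (T d) 3 (just 2)) ×
    (3 < d → MsadIs (T d) 3 (just 1))
proposition15 d _ =
  (λ { refl → msad₃-T₂ }) ,
  (λ { refl → msad₃-T₃ }) ,
  (λ 4≤d → Classes.singleton-MARS⇒msad≡1 (T d) (Vertex₁-MARS.⁅vertex₁⁆-isMARS d 4≤d))
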